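{- For every $n\ge0$, the sequence of coefficients of the genus polynomial $\Gamma_{Y_n}(z)$ of the iterated claw $Y_n$ has no internal zeros.
   Context: All embeddings are cellular embeddings in closed orientable surfaces, counted up to combinatorial equivalence. The genus polynomial of a connected graph $G$ is $\Gamma_G(z)=\sum_{i\ge0}g_i(G)z^i$, where $g_i(G)$ is the number of embeddings of $G$ in the orientable surface of genus $i$. The iterated claws $Y_n$: $Y_0$ is the dipole $D_3$ (two vertices joined by three parallel edges) with root $u_0$ one of its vertices; for $n\ge1$, $Y_n$ (with root $u_n$) is obtained from $Y_{n-1}$ by subdividing each of the three edges incident on the root $u_{n-1}$ and joining the three new vertices to a new vertex $u_n$. A sequence $(a_k)$ has an internal zero if there are $i<k<j$ with $a_ia_j\ne0$ and $a_k=0$. -}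

module Defs where

open import Data.Nat using (ℕ; zero; suc; _+_; _*_; _≤ᵇ_; _≡ᵇ_)
open import Data.Bool using (Bool; true; false; _∧_; _∨_; not; if_then_else_)
open import Data.Fin using (Fin; toℕ; combine; remQuot; _≟_)
open import Data.Fin as F using ()
open import Data.List using (List; []; _∷_; length; lookup; map; concatMap; filter; foldr)
open import Data.Bool.ListAction using (all; any)
open import Relation.Nullary using (¬_)
open import Data.Product using (Σ)
open import Data.Nat using (_<_)
open import Data.List using (allFin)
open import Data.Vec as V using (Vec)
open import Data.Product using (_×_; _,_; proj₁; proj₂)
open import Relation.Nullary.Decidable using (⌊_⌋)
open import Relation.Binary.PropositionalEquality using (_≡_)

-- Graphs (multigraphs, loops allowed in principle).
-- Vertices are the labels 0 … nV-1; edges are given as a list of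
-- ordered pairs of endpoints.

record Graph : Set where
  constructor mkGraph
  field
    nV    : ℕ
    edges : List (ℕ × ℕ)

  nE : ℕ
  nE = length edges

  -- darts (half-edges): dart = combine e s with e an edge, s ∈ Fin 2;
  -- s = 0 is the half-edge at the first endpoint, s = 1 at the second.
  nD : ℕ
  nD = nE * 2

  Dart : Set
  Dart = Fin nD

  tail : Dart → ℕ
  tail d with remQuot {nE} 2 d
  ... | e , F.zero   = proj₁ (lookup edges e)
  ... | e , F.suc _  = proj₂ (lookup edges e)

  θ : Dart → Dart
  θ d with remQuot {nE} 2 d
  ... | e , F.zero  = combine e (F.suc F.zero)
  ... | e , F.suc _ = combine e F.zero

iter : {A : Set} → (A → A) → ℕ → A → A
iter f zero    x = x
iter f (suc k) x = f (iter f k x)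

allVecs : {A : Set} → List A → (k : ℕ) → List (Vec A k)
allVecs xs zero    = V.[] ∷ []
allVecs xs (suc k) = concatMap (λ x → map (x V.∷_) (allVecs xs k)) xs

count : {A : Set} → (A → Bool) → List A → ℕ
count p xs = foldr (λ x n → if p x then suc n else n) 0 xs

upTo : ℕ → List ℕ
upTo zero    = []
upTo (suc n) = upTo n Data.List.++ (n ∷ [])

_==_ : {n : ℕ} → Fin n → Fin n → Bool
a == b = ⌊ a ≟ b ⌋

module _ (G : Graph) where
  open Graph G

  Table : Set
  Table = Vec Dart nD

  rot : Table → Dart → Dart
  rot t = V.lookup t

  -- t is a rotation system: ρ = rot t permutes the darts, fixes each
  -- vertex (tail (ρ d) = tail d), and its restriction to the darts at
  -- each vertex is a single cycle (every dart at v is reached from every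
  -- other dart at v).  Together these say exactly that ρ is a cyclic
  -- permutation of the darts at each vertex.
  isRotation : Table → Bool
  isRotation t =
    all (λ d → (tail (rot t d) ≡ᵇ tail d)) (allFin nD)
    ∧ all (λ d → all (λ d' → not (rot t d == rot t d') ∨ (d == d'))
                     (allFin nD)) (allFin nD)
    ∧ all (λ d → all (λ d' → not (tail d ≡ᵇ tail d')
                               ∨ any (λ k → iter (rot t) k d == d') (upTo nD))
                     (allFin nD)) (allFin nD)

  facePerm : Table → Dart → Dart
  facePerm t d = rot t (θ d)

  -- number of faces = number of φ-orbits, counted by their least dart
  numFaces : Table → ℕ
  numFaces t =
    count (λ d → all (λ k → toℕ d ≤ᵇ toℕ (iter (facePerm t) k d)) (upTo nD))
          (allFin nD)

  -- Euler's formula: the embedding given by t has genus i iff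
  -- V - E + F = 2 - 2i.
  hasGenus : ℕ → Table → Bool
  hasGenus i t = (nV + numFaces t + 2 * i) ≡ᵇ (2 + nE)

  allRotationSystems : List Table
  allRotationSystems = filter (λ t → Data.Bool._≟_ (isRotation t) true)
                              (allVecs (allFin nD) nD)

  -- g_i(G): number of embeddings (rotation systems) of G of genus i;
  -- the coefficient of z^i in the genus polynomial Γ_G(z).
  genusCoeff : ℕ → ℕ
  genusCoeff i = count (hasGenus i) allRotationSystems

HasInternalZero : (ℕ → ℕ) → Set
HasInternalZero a =
  Σ ℕ λ i → Σ ℕ λ k → Σ ℕ λ j →
    (i < k) × (k < j) ×
    (¬ (a i ≡ 0)) × (¬ (a j ≡ 0)) × (a k ≡ 0)

-- Iterated claws.  The data (nV , root , edges) is maintained so that the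
-- first three edges are the three edges incident on the root, written
-- (root , other endpoint).

YData : ℕ → ℕ × ℕ × List (ℕ × ℕ)
-- Y₀ = D₃ on vertices 0 (= u₀, the root) and 1.
YData zero = 2 , 0 , ((0 , 1) ∷ (0 , 1) ∷ (0 , 1) ∷ [])
YData (suc n) with YData n
... | v , r , ((_ , x₁) ∷ (_ , x₂) ∷ (_ , x₃) ∷ rest) =
  -- subdivision vertices s₁ s₂ s₃ = v, v+1, v+2 ; new root u = v+3
  let s₁ = v ; s₂ = v + 1 ; s₃ = v + 2 ; u = v + 3 in
  (v + 4) , u ,
  ((u , s₁) ∷ (u , s₂) ∷ (u , s₃) ∷
   (r , s₁) ∷ (s₁ , x₁) ∷ (r , s₂) ∷ (s₂ , x₂) ∷ (r , s₃) ∷ (s₃ , x₃) ∷ rest)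
... | other = other   -- unreachable: YData n always has ≥ 3 edges

Y : ℕ → Graph
Y n = mkGraph (proj₁ (YData n)) (proj₂ (proj₂ (YData n)))

-- Faces of an embedding are the cycles of the face permutation ρ ∘ θ.  At a vertex of
-- degree three a rotation is one of the two cyclic orders of its darts, and reversing it
-- composes ρ with two transpositions.  Composing a permutation with a transposition
-- merges two of its cycles or splits one, so changing the rotation at a single vertex of a
-- cubic graph changes the number of faces by 0 or ±2, i.e. the genus by at most one.
-- Passing from one embedding to another vertex by vertex therefore meets every genus in
-- between, and the iterated claws are cubic.

module Submission where

open import Defs
open import Data.Nat as ℕ using (ℕ; zero; suc; _+_; _*_; _∸_; _≤_; _<_; _≤ᵇ_; _<ᵇ_; _≡ᵇ_; z<s; s<s; s≤s)
open import Data.Nat.Properties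
  using (≤-totalOrder; ≤-refl; ≤-trans; ≤-reflexive; ≤-pred; ≤-antisym; ≤-<-trans; <⇒≤; n<1+n; m≤n+m; m≤m+n;
         +-suc; +-identityʳ; +-cancelˡ-≤; +-cancelˡ-≡; suc-injective; 0≢1+n; m∸n+n≡m; m≤n⇒m≤1+n;
         m<1+n⇒m<n∨m≡n; m<n⇒m<1+n; ≤ᵇ⇒≤; ≤⇒≤ᵇ; <⇒<ᵇ; ≡ᵇ⇒≡; ≡⇒≡ᵇ; m≤n⇒∃[o]m+o≡n)
open import Data.Nat.DivMod using (_%_; _/_; m≡m%n+[m/n]*n; m%n<n)
open import Data.Nat.Tactic.RingSolver using (solve-∀)
open import Data.Bool as Bool using (Bool; true; false; T; not; _∧_; _∨_; if_then_else_)
open import Data.Bool.ListAction using (all; any; and)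
open import Data.Bool.Properties using (T-∧; T-≡; ∧-zeroʳ)
open import Data.Fin as Fin using (Fin; toℕ; fromℕ<; combine; remQuot; _≟_)
open import Data.Fin.Properties as Finₚ
  using (pigeonhole; any?; toℕ<n; toℕ-fromℕ<; toℕ-injective; remQuot-combine; combine-remQuot)
open import Data.Fin.Permutation.Components using (transpose)
open import Data.List using (List; []; _∷_; length; map; allFin; tabulate)
open import Data.List.Properties using (map-cong)
open import Data.List.Relation.Unary.All as All using ()
open import Data.List.Relation.Unary.All.Properties using (all⁺; all⁻)
open import Data.List.Relation.Unary.Any as Any using (here; there)
open import Data.List.Relation.Unary.Any.Properties using (any⁺; any⁻)
open import Data.List.Membership.Propositional using (_∈_; find; lose)
open import Data.List.Membership.Propositional.Properties
  using (∈-++⁺ˡ; ∈-++⁺ʳ; ∈-++⁻; ∈-allFin; ∈-map⁺; ∈-map⁻; ∈-filter⁺; ∈-filter⁻; ∈-concatMap⁺)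
open import Data.List.Extrema ≤-totalOrder using (argmin; argmin-sel; f[argmin]≤f[xs]; max; xs≤max)
open import Data.Vec as Vec using (Vec)
open import Data.Vec.Properties using (lookup∘tabulate)
open import Data.Product using (∃; ∃₂; _×_; _,_; proj₁; proj₂; uncurry)
open import Data.Sum as Sum using (_⊎_; inj₁; inj₂)
open import Data.Empty using (⊥; ⊥-elim)
open import Function using (_∘_; id)
open import Function.Bundles using (Equivalence; mk⇔)
open import Function.Definitions using (Injective)
open import Relation.Nullary using (¬_; Dec; yes; no)
open import Relation.Nullary.Decidable
  using (⌊_⌋; _⊎-dec_; does-⇔; isYes≗does; decidable-stable; dec-true; dec-false;
         toWitness; fromWitness; toWitnessFalse; fromWitnessFalse)
open import Relation.Unary using (Decidable)
open import Relation.Binary.PropositionalEquality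
  using (_≡_; _≢_; refl; sym; trans; cong; cong₂; subst; module ≡-Reasoning)

open Equivalence using (to; from)

count-cong : {A : Set} {p q : A → Bool} → (∀ x → p x ≡ q x) → ∀ xs → count p xs ≡ count q xs
count-cong p≗q []       = refl
count-cong p≗q (x ∷ xs) rewrite p≗q x | count-cong p≗q xs = refl

count-∧-split : {A : Set} (p q : A → Bool) (xs : List A) →
  count p xs ≡ count (λ x → p x ∧ q x) xs + count (λ x → p x ∧ not (q x)) xs
count-∧-split p q [] = refl
count-∧-split p q (x ∷ xs) with p x | q x
... | false | _     = count-∧-split p q xs
... | true  | true  = cong suc (count-∧-split p q xs)
... | true  | false = trans (cong suc (count-∧-split p q xs)) (sym (+-suc _ _))

count-none : {A : Set} {p : A → Bool} → (∀ x → ¬ T (p x)) → ∀ xs → count p xs ≡ 0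
count-none ¬p [] = refl
count-none {p = p} ¬p (x ∷ xs) with p x in px
... | true  = ⊥-elim (¬p x (subst T (sym px) _))
... | false = count-none ¬p xs

count≢0⇒∃ : {A : Set} {p : A → Bool} (xs : List A) → count p xs ≢ 0 → ∃ λ x → x ∈ xs × T (p x)
count≢0⇒∃ [] c≢0 = ⊥-elim (c≢0 refl)
count≢0⇒∃ {p = p} (x ∷ xs) c≢0 with p x in px
... | true  = x , here refl , subst T (sym px) _
... | false with count≢0⇒∃ xs c≢0
...   | y , y∈xs , py = y , there y∈xs , py

∈⇒count≢0 : {A : Set} {p : A → Bool} {x : A} {xs : List A} → x ∈ xs → T (p x) → count p xs ≢ 0
∈⇒count≢0 {p = p} {xs = y ∷ ys} x∈ px with p y in py
... | true = λ ()
... | false with x∈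
...   | here refl  = ⊥-elim (subst T py px)
...   | there x∈ys = ∈⇒count≢0 x∈ys px

count-tabulate : {A : Set} (n : ℕ) (h : Fin n → A) (p : A → Bool) →
  count p (tabulate h) ≡ count (p ∘ h) (allFin n)
count-tabulate zero    h p = refl
count-tabulate (suc n) h p =
  cong (λ c → if p (h Fin.zero) then suc c else c)
       (trans (count-tabulate n (h ∘ Fin.suc) p) (sym (count-tabulate n Fin.suc (p ∘ h))))

count-allFin-≡1 : {n : ℕ} {q : Fin n → Bool} {u : Fin n} →
  T (q u) → (∀ d → T (q d) → d ≡ u) → count q (allFin n) ≡ 1
count-allFin-≡1 {suc n} {q} {Fin.zero} qu only-u with q Fin.zero
... | true = cong suc (trans (count-tabulate n Fin.suc q)
               (count-none (λ d qd → Finₚ.0≢1+n (sym (only-u (Fin.suc d) qd))) (allFin n)))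
count-allFin-≡1 {suc n} {q} {Fin.suc u} qu only-u with q Fin.zero in q0
... | true  = ⊥-elim (Finₚ.0≢1+n (only-u Fin.zero (subst T (sym q0) _)))
... | false = trans (count-tabulate n Fin.suc q)
                (count-allFin-≡1 {q = q ∘ Fin.suc} qu (λ d qd → Finₚ.suc-injective (only-u (Fin.suc d) qd)))

_except_ : {n : ℕ} → (Fin n → Bool) → Fin n → Fin n → Bool
(q except u) d = q d ∧ not ⌊ d ≟ u ⌋

except⁻ : {n : ℕ} {q : Fin n → Bool} {u d : Fin n} → T ((q except u) d) → T (q d) × d ≢ u
except⁻ {q = q} {u} {d} h with q d
... | true = _ , toWitnessFalse {a? = d ≟ u} h

except⁺ : {n : ℕ} {q : Fin n → Bool} {u d : Fin n} → T (q d) → d ≢ u → T ((q except u) d)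
except⁺ {q = q} {u} {d} qd d≢u with q d
... | true = fromWitnessFalse {a? = d ≟ u} d≢u

count-allFin-remove : {n : ℕ} {q : Fin n → Bool} {u : Fin n} → T (q u) →
  count q (allFin n) ≡ suc (count (q except u) (allFin n))
count-allFin-remove {n} {q} {u} qu =
  trans (count-∧-split q (λ d → ⌊ d ≟ u ⌋) (allFin n))
        (cong (_+ count (q except u) (allFin n)) (count-allFin-≡1 {q = λ d → q d ∧ ⌊ d ≟ u ⌋} q∧≡u only-u))
  where
  q∧≡u : T (q u ∧ ⌊ u ≟ u ⌋)
  q∧≡u = from T-∧ (qu , fromWitness refl)
  only-u : ∀ d → T (q d ∧ ⌊ d ≟ u ⌋) → d ≡ u
  only-u d h = toWitness {a? = d ≟ u} (proj₂ (to (T-∧ {q d}) h))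

count-allFin-pick : {n k : ℕ} {q : Fin n → Bool} → count q (allFin n) ≡ suc k →
  ∃ λ y → T (q y) × count (q except y) (allFin n) ≡ k
count-allFin-pick {n} {q = q} c≡1+k with count≢0⇒∃ {p = q} (allFin n) (λ c≡0 → 0≢1+n (trans (sym c≡0) c≡1+k))
... | y , _ , qy = y , qy , suc-injective (trans (sym (count-allFin-remove {q = q} qy)) c≡1+k)

locate3 : {n : ℕ} (x y z w : Fin n) → w ≡ x ⊎ w ≡ y ⊎ w ≡ z ⊎ (w ≢ x × w ≢ y × w ≢ z)
locate3 x y z w with w ≟ x | w ≟ y | w ≟ z
... | yes w≡x | _       | _       = inj₁ w≡x
... | no _    | yes w≡y | _       = inj₂ (inj₁ w≡y)
... | no _    | no _    | yes w≡z = inj₂ (inj₂ (inj₁ w≡z))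
... | no w≢x  | no w≢y  | no w≢z  = inj₂ (inj₂ (inj₂ (w≢x , w≢y , w≢z)))

count-allFin-≡3 : {n : ℕ} {q : Fin n → Bool} {x : Fin n} → T (q x) → count q (allFin n) ≡ 3 →
  ∃₂ λ y z → x ≢ y × y ≢ z × x ≢ z × T (q y) × T (q z) × (∀ d → T (q d) → d ≡ x ⊎ d ≡ y ⊎ d ≡ z)
count-allFin-≡3 {n} {q} {x} qx c≡3
  with count-allFin-pick {q = q except x} (suc-injective (trans (sym (count-allFin-remove {q = q} qx)) c≡3))
... | y , q₁y , c₂≡1 with count-allFin-pick c₂≡1
...   | z , q₂z , c₃≡0 with except⁻ {q = q} q₁y | except⁻ {q = q except x} q₂z
...     | qy , y≢x | q₁z , z≢y with except⁻ {q = q} q₁z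
...       | qz , z≢x = y , z , y≢x ∘ sym , z≢y ∘ sym , z≢x ∘ sym , qy , qz , only
  where
  only : ∀ d → T (q d) → d ≡ x ⊎ d ≡ y ⊎ d ≡ z
  only d qd with locate3 x y z d
  ... | inj₁ d≡x               = inj₁ d≡x
  ... | inj₂ (inj₁ d≡y)        = inj₂ (inj₁ d≡y)
  ... | inj₂ (inj₂ (inj₁ d≡z)) = inj₂ (inj₂ d≡z)
  ... | inj₂ (inj₂ (inj₂ (d≢x , d≢y , d≢z))) = ⊥-elim (∈⇒count≢0 (∈-allFin d)
          (except⁺ {q = (q except x) except y} (except⁺ {q = q except x} (except⁺ {q = q} qd d≢x) d≢y) d≢z) c₃≡0)

all-allFin⁻ : {n : ℕ} (p : Fin n → Bool) → T (all p (allFin n)) → ∀ d → T (p d)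
all-allFin⁻ {n} p h d = All.lookup (all⁺ p (allFin n) h) (∈-allFin d)

all-allFin⁺ : {n : ℕ} (p : Fin n → Bool) → (∀ d → T (p d)) → T (all p (allFin n))
all-allFin⁺ {n} p h = all⁻ p {allFin n} (All.tabulate (λ {d} _ → h d))

T-implies⁻ : ∀ {a b} → T (not a ∨ b) → T a → T b
T-implies⁻ {true} h _ = h

T-implies⁺ : ∀ {a b} → (T a → T b) → T (not a ∨ b)
T-implies⁺ {true}  h = h _
T-implies⁺ {false} h = _

∈-upTo⁺ : {k n : ℕ} → k < n → k ∈ upTo n
∈-upTo⁺ {n = suc n} k<1+n with m<1+n⇒m<n∨m≡n k<1+n
... | inj₁ k<n  = ∈-++⁺ˡ (∈-upTo⁺ k<n)
... | inj₂ refl = ∈-++⁺ʳ (upTo n) (here refl)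

∈-upTo⁻ : {k n : ℕ} → k ∈ upTo n → k < n
∈-upTo⁻ {n = suc n} k∈ with ∈-++⁻ (upTo n) k∈
... | inj₁ k∈upTo-n   = m<n⇒m<1+n (∈-upTo⁻ k∈upTo-n)
... | inj₂ (here refl) = n<1+n n

∈-allVecs : {A : Set} (xs : List A) (k : ℕ) (v : Vec A k) → (∀ i → Vec.lookup v i ∈ xs) → v ∈ allVecs xs k
∈-allVecs xs zero    Vec.[]      _    = here refl
∈-allVecs xs (suc k) (x Vec.∷ v) v⊆xs = ∈-concatMap⁺ (λ y → map (y Vec.∷_) (allVecs xs k))
  (Any.map (λ { refl → ∈-map⁺ (x Vec.∷_) (∈-allVecs xs k v (v⊆xs ∘ Fin.suc)) }) (v⊆xs Fin.zero))

iter-+ : {A : Set} (f : A → A) (m n : ℕ) (x : A) → iter f (m + n) x ≡ iter f m (iter f n x)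
iter-+ f zero    n x = refl
iter-+ f (suc m) n x = cong f (iter-+ f m n x)

iter-cong : {A : Set} {f g : A → A} → (∀ x → f x ≡ g x) → ∀ k x → iter f k x ≡ iter g k x
iter-cong f≗g zero    x = refl
iter-cong {f = f} f≗g (suc k) x = trans (cong f (iter-cong f≗g k x)) (f≗g _)

iter-periodic : {A : Set} (f : A → A) {p : ℕ} {x : A} → iter f p x ≡ x → ∀ q → iter f (q * p) x ≡ x
iter-periodic f         fᵖx≡x zero    = refl
iter-periodic f {p} {x} fᵖx≡x (suc q) =
  trans (iter-+ f p (q * p) x) (trans (cong (iter f p) (iter-periodic f fᵖx≡x q)) fᵖx≡x)

iter-within-period : {A : Set} (f : A → A) {p : ℕ} {x y : A} → iter f (suc p) x ≡ x →
  ∀ k → iter f k x ≡ y → ∃ λ i → i ≤ p × iter f i x ≡ y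
iter-within-period f {p} {x} {y} periodic k fᵏx≡y = k % suc p , ≤-pred (m%n<n k (suc p)) , (begin
  iter f (k % suc p) x                              ≡⟨ cong (iter f (k % suc p))
                                                          (sym (iter-periodic f periodic (k / suc p))) ⟩
  iter f (k % suc p) (iter f (k / suc p * suc p) x) ≡⟨ sym (iter-+ f (k % suc p) _ x) ⟩
  iter f (k % suc p + k / suc p * suc p) x          ≡⟨ cong (λ j → iter f j x) (sym (m≡m%n+[m/n]*n k (suc p))) ⟩
  iter f k x                                        ≡⟨ fᵏx≡y ⟩
  y                                                 ∎)
  where open ≡-Reasoning

least-witness : {P : ℕ → Set} → Decidable P → ∀ {n} → P n → ∃ λ m → P m × (∀ j → j < m → ¬ P j)
least-witness P? {zero} p0 = zero , p0 , λ j ()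
least-witness P? {suc n} pn with P? zero
... | yes p0 = zero , p0 , λ j ()
... | no ¬p0 with least-witness (P? ∘ suc) pn
...   | m , pm , below-m = suc m , pm , λ { zero _ → ¬p0 ; (suc j) (s≤s j<m) → below-m j j<m }

transpose-matchˡ : {n : ℕ} (i j : Fin n) → transpose i j i ≡ j
transpose-matchˡ i j rewrite dec-true (i ≟ i) refl = refl

transpose-matchʳ : {n : ℕ} (i j : Fin n) → transpose i j j ≡ i
transpose-matchʳ i j with j ≟ i
... | yes j≡i = j≡i
... | no  _   rewrite dec-true (j ≟ j) refl = refl

transpose-mismatch : {n : ℕ} {i j k : Fin n} → k ≢ i → k ≢ j → transpose i j k ≡ k
transpose-mismatch {i = i} {j} {k} k≢i k≢j rewrite dec-false (k ≟ i) k≢i | dec-false (k ≟ j) k≢j = refl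

transpose-involutive : {n : ℕ} (i j k : Fin n) → transpose i j (transpose i j k) ≡ k
transpose-involutive i j k with k ≟ i
... | yes refl = transpose-matchʳ k j
... | no k≢i with k ≟ j
...   | yes refl = transpose-matchˡ i k
...   | no k≢j   = transpose-mismatch k≢i k≢j

transpose-injective : {n : ℕ} (i j : Fin n) → Injective _≡_ _≡_ (transpose i j)
transpose-injective i j {x} {y} eq =
  trans (sym (transpose-involutive i j x)) (trans (cong (transpose i j) eq) (transpose-involutive i j y))

transpose-conjugate : {n : ℕ} {θ : Fin n → Fin n} → (∀ d → θ (θ d) ≡ d) →
  ∀ i j d → θ (transpose (θ i) (θ j) d) ≡ transpose i j (θ d)
transpose-conjugate {θ = θ} θθ i j d with d ≟ θ i
... | yes refl = trans (θθ j) (sym (trans (cong (transpose i j) (θθ i)) (transpose-matchˡ i j)))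
... | no d≢θi with d ≟ θ j
...   | yes refl = trans (θθ i) (sym (trans (cong (transpose i j) (θθ j)) (transpose-matchʳ i j)))
...   | no d≢θj  = sym (transpose-mismatch (d≢θi ∘ flip-θ) (d≢θj ∘ flip-θ))
  where
  flip-θ : ∀ {e} → θ d ≡ e → d ≡ θ e
  flip-θ refl = sym (θθ d)

-- Orbits of an injection of a finite set

Reach : {A : Set} → (A → A) → A → A → Set
Reach f x y = ∃ λ k → iter f k x ≡ y

Touches : {A : Set} → (A → A) → A → A → A → Set
Touches f a b d = Reach f d a ⊎ Reach f d b

isOrbitMin : {N : ℕ} → (Fin N → Fin N) → Fin N → Bool
isOrbitMin {N} f d = all (λ k → toℕ d ≤ᵇ toℕ (iter f k d)) (upTo N)

orbitCount : {N : ℕ} → (Fin N → Fin N) → ℕ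
orbitCount {N} f = count (isOrbitMin f) (allFin N)

isOrbitMin-cong : {N : ℕ} {f g : Fin N → Fin N} {d : Fin N} →
  (∀ k → iter f k d ≡ iter g k d) → isOrbitMin f d ≡ isOrbitMin g d
isOrbitMin-cong {N} {d = d} same-iterates =
  cong and (map-cong (λ k → cong (λ y → toℕ d ≤ᵇ toℕ y) (same-iterates k)) (upTo N))

orbitCount-cong : {N : ℕ} {f g : Fin N → Fin N} → (∀ x → f x ≡ g x) → orbitCount f ≡ orbitCount g
orbitCount-cong {N} f≗g = count-cong (λ d → isOrbitMin-cong (λ k → iter-cong f≗g k d)) (allFin N)

module Orbits {N : ℕ} (f : Fin N → Fin N) (f-injective : Injective _≡_ _≡_ f) where

  iter-injective : ∀ k → Injective _≡_ _≡_ (iter f k)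
  iter-injective zero    eq = eq
  iter-injective (suc k) eq = iter-injective k (f-injective eq)

  period : ∀ x → ∃ λ p → p < N × iter f (suc p) x ≡ x
  period x with pigeonhole (n<1+n N) (λ i → iter f (toℕ i) x)
  ... | i , j , i<j , fⁱx≡fʲx with m≤n⇒∃[o]m+o≡n i<j
  ...   | p , i+1+p≡j = p , p<N , iter-injective (toℕ i) (sym (begin
          iter f (toℕ i) x                  ≡⟨ fⁱx≡fʲx ⟩
          iter f (toℕ j) x                  ≡⟨ cong (λ k → iter f k x) (sym (trans (+-suc (toℕ i) p) i+1+p≡j)) ⟩
          iter f (toℕ i + suc p) x          ≡⟨ iter-+ f (toℕ i) (suc p) x ⟩
          iter f (toℕ i) (iter f (suc p) x) ∎))
    where
    open ≡-Reasoning
    p<N : p < N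
    p<N = ≤-trans (s≤s (m≤n+m p (toℕ i))) (≤-trans (≤-reflexive i+1+p≡j) (≤-pred (toℕ<n j)))

  reach-bounded : ∀ {x y} → Reach f x y → ∃ λ k → k < N × iter f k x ≡ y
  reach-bounded {x} (k , fᵏx≡y) with period x
  ... | p , p<N , periodic with iter-within-period f periodic k fᵏx≡y
  ...   | i , i≤p , fⁱx≡y = i , ≤-<-trans i≤p p<N , fⁱx≡y

  reach-trans : ∀ {x y z} → Reach f x y → Reach f y z → Reach f x z
  reach-trans {x} (k , refl) (l , refl) = l + k , iter-+ f l k x

  reach-sym : ∀ {x y} → Reach f x y → Reach f y x
  reach-sym {x} (k , fᵏx≡y) with period x
  ... | p , _ , periodic with iter-within-period f periodic k fᵏx≡y
  ...   | i , i≤p , refl = suc p ∸ i , (begin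
          iter f (suc p ∸ i) (iter f i x) ≡⟨ sym (iter-+ f (suc p ∸ i) i x) ⟩
          iter f (suc p ∸ i + i) x        ≡⟨ cong (λ j → iter f j x) (m∸n+n≡m (m≤n⇒m≤1+n i≤p)) ⟩
          iter f (suc p) x                ≡⟨ periodic ⟩
          x                               ∎)
    where open ≡-Reasoning

  reach? : ∀ x y → Dec (Reach f x y)
  reach? x y with any? (λ (k : Fin N) → iter f (toℕ k) x ≟ y)
  ... | yes (k , fᵏx≡y) = yes (toℕ k , fᵏx≡y)
  ... | no ¬∃ = no λ r → let k , k<N , fᵏx≡y = reach-bounded r in
                         ¬∃ (fromℕ< k<N , trans (cong (λ j → iter f j x) (toℕ-fromℕ< k<N)) fᵏx≡y)

  isOrbitMin⁺ : ∀ {d} → (∀ y → Reach f d y → toℕ d ≤ toℕ y) → T (isOrbitMin f d)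
  isOrbitMin⁺ {d} minimal =
    all⁻ (λ k → toℕ d ≤ᵇ toℕ (iter f k d)) {upTo N} (All.tabulate (λ {k} _ → ≤⇒≤ᵇ (minimal _ (k , refl))))

  isOrbitMin⁻ : ∀ {d y} → T (isOrbitMin f d) → Reach f d y → toℕ d ≤ toℕ y
  isOrbitMin⁻ d-min r with reach-bounded r
  ... | k , k<N , refl = ≤ᵇ⇒≤ _ _ (All.lookup (all⁺ _ (upTo N) d-min) (∈-upTo⁺ k<N))

  orbit : Fin N → List (Fin N)
  orbit x = map (λ k → iter f k x) (upTo N)

  orbitMin : Fin N → Fin N
  orbitMin x = argmin toℕ x (orbit x)

  reach-orbitMin : ∀ x → Reach f x (orbitMin x)
  reach-orbitMin x with argmin-sel toℕ x (orbit x)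
  ... | inj₁ m≡x     = 0 , sym m≡x
  ... | inj₂ m∈orbit with ∈-map⁻ (λ k → iter f k x) m∈orbit
  ...   | k , _ , m≡fᵏx = k , sym m≡fᵏx

  orbitMin-minimal : ∀ {x y} → Reach f x y → toℕ (orbitMin x) ≤ toℕ y
  orbitMin-minimal {x} r with reach-bounded r
  ... | k , k<N , refl =
    All.lookup (f[argmin]≤f[xs] {f = toℕ} x (orbit x)) (∈-map⁺ (λ k → iter f k x) (∈-upTo⁺ k<N))

  isOrbitMin-orbitMin : ∀ x → T (isOrbitMin f (orbitMin x))
  isOrbitMin-orbitMin x = isOrbitMin⁺ (λ y r → orbitMin-minimal (reach-trans (reach-orbitMin x) r))

  isOrbitMin-unique : ∀ {d e} → T (isOrbitMin f d) → T (isOrbitMin f e) → Reach f d e → d ≡ e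
  isOrbitMin-unique d-min e-min r =
    toℕ-injective (≤-antisym (isOrbitMin⁻ d-min r) (isOrbitMin⁻ e-min (reach-sym r)))

  touches? : ∀ a b d → Dec (Touches f a b d)
  touches? a b d = reach? d a ⊎-dec reach? d b

  TouchingMin : Fin N → Fin N → Fin N → Bool
  TouchingMin a b d = isOrbitMin f d ∧ ⌊ touches? a b d ⌋

  touchingMins otherMins : Fin N → Fin N → ℕ
  touchingMins a b = count (TouchingMin a b) (allFin N)
  otherMins    a b = count (λ d → isOrbitMin f d ∧ not ⌊ touches? a b d ⌋) (allFin N)

  orbitCount-split : ∀ a b → orbitCount f ≡ touchingMins a b + otherMins a b
  orbitCount-split a b = count-∧-split (isOrbitMin f) (λ d → ⌊ touches? a b d ⌋) (allFin N)

  touchingMin⇒orbitMin : ∀ {a b d} → T (TouchingMin a b d) → d ≡ orbitMin a ⊎ d ≡ orbitMin b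
  touchingMin⇒orbitMin {a} {b} h with to T-∧ h
  ... | d-min , touching with toWitness {a? = touches? a b _} touching
  ...   | inj₁ r = inj₁ (isOrbitMin-unique d-min (isOrbitMin-orbitMin a) (reach-trans r (reach-orbitMin a)))
  ...   | inj₂ r = inj₂ (isOrbitMin-unique d-min (isOrbitMin-orbitMin b) (reach-trans r (reach-orbitMin b)))

  touchingMin-orbitMinˡ : ∀ a b → T (TouchingMin a b (orbitMin a))
  touchingMin-orbitMinˡ a b =
    from T-∧ (isOrbitMin-orbitMin a , fromWitness (inj₁ (reach-sym (reach-orbitMin a))))

  touchingMin-orbitMinʳ : ∀ a b → T (TouchingMin a b (orbitMin b))
  touchingMin-orbitMinʳ a b =
    from T-∧ (isOrbitMin-orbitMin b , fromWitness (inj₂ (reach-sym (reach-orbitMin b))))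

  touchingMins-linked : ∀ {a b} → Reach f a b → touchingMins a b ≡ 1
  touchingMins-linked {a} {b} a↝b = count-allFin-≡1 (touchingMin-orbitMinˡ a b)
    (λ d → Sum.[ id , (λ d≡mb → trans d≡mb (sym ma≡mb)) ] ∘ touchingMin⇒orbitMin)
    where
    ma≡mb : orbitMin a ≡ orbitMin b
    ma≡mb = isOrbitMin-unique (isOrbitMin-orbitMin a) (isOrbitMin-orbitMin b)
              (reach-trans (reach-sym (reach-orbitMin a)) (reach-trans a↝b (reach-orbitMin b)))

  touchingMins-unlinked : ∀ {a b} → ¬ Reach f a b → touchingMins a b ≡ 2
  touchingMins-unlinked {a} {b} ¬a↝b =
    trans (count-allFin-remove {q = TouchingMin a b} (touchingMin-orbitMinˡ a b))
          (cong suc (count-allFin-≡1 (except⁺ {q = TouchingMin a b} (touchingMin-orbitMinʳ a b) mb≢ma) only-mb))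
    where
    mb≢ma : orbitMin b ≢ orbitMin a
    mb≢ma mb≡ma =
      ¬a↝b (reach-trans (reach-orbitMin a) (subst (λ m → Reach f m b) mb≡ma (reach-sym (reach-orbitMin b))))
    only-mb : ∀ d → T ((TouchingMin a b except orbitMin a) d) → d ≡ orbitMin b
    only-mb d h with except⁻ {q = TouchingMin a b} h
    ... | touching , d≢ma with touchingMin⇒orbitMin touching
    ...   | inj₁ d≡ma = ⊥-elim (d≢ma d≡ma)
    ...   | inj₂ d≡mb = d≡mb

module _ {N : ℕ} {f g : Fin N → Fin N} {a b : Fin N} (g≗f∘τ : ∀ d → g d ≡ f (transpose a b d)) where

  iter-untouched : ∀ {d} → ¬ Touches f a b d → ∀ k → iter g k d ≡ iter f k d
  iter-untouched ¬t zero    = refl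
  iter-untouched ¬t (suc k) rewrite iter-untouched ¬t k =
    trans (g≗f∘τ _) (cong f (transpose-mismatch (λ e → ¬t (inj₁ (k , e))) (λ e → ¬t (inj₂ (k , e)))))

  untouched-transpose : ∀ {d} → ¬ Touches f a b d → ¬ Touches g a b d
  untouched-transpose ¬t (inj₁ (k , e)) = ¬t (inj₁ (k , trans (sym (iter-untouched ¬t k)) e))
  untouched-transpose ¬t (inj₂ (k , e)) = ¬t (inj₂ (k , trans (sym (iter-untouched ¬t k)) e))

module Transposition {N : ℕ} (f g : Fin N → Fin N) (a b : Fin N) (a≢b : a ≢ b)
  (f-injective : Injective _≡_ _≡_ f) (g-injective : Injective _≡_ _≡_ g)
  (g≗f∘τ : ∀ d → g d ≡ f (transpose a b d)) where

  module F = Orbits f f-injective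
  module G = Orbits g g-injective

  f≗g∘τ : ∀ d → f d ≡ g (transpose a b d)
  f≗g∘τ d = trans (cong f (sym (transpose-involutive a b d))) (sym (g≗f∘τ (transpose a b d)))

  touches-agree : ∀ d → ⌊ F.touches? a b d ⌋ ≡ ⌊ G.touches? a b d ⌋
  touches-agree d = trans (isYes≗does (F.touches? a b d)) (trans (does-⇔
    (mk⇔ (λ t → decidable-stable (G.touches? a b d) (λ ¬t → untouched-transpose f≗g∘τ ¬t t))
         (λ t → decidable-stable (F.touches? a b d) (λ ¬t → untouched-transpose g≗f∘τ ¬t t)))
    (F.touches? a b d) (G.touches? a b d)) (sym (isYes≗does (G.touches? a b d))))

  otherMins-agree : F.otherMins a b ≡ G.otherMins a b
  otherMins-agree = count-cong same (allFin N)
    where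
    same : ∀ d → isOrbitMin f d ∧ not ⌊ F.touches? a b d ⌋ ≡ isOrbitMin g d ∧ not ⌊ G.touches? a b d ⌋
    same d rewrite sym (touches-agree d) with F.touches? a b d
    ... | yes _ = trans (∧-zeroʳ _) (sym (∧-zeroʳ _))
    ... | no ¬t = cong (_∧ true) (isOrbitMin-cong (λ k → sym (iter-untouched g≗f∘τ ¬t k)))

  -- Follow the f-orbit of b up to its first return J to a or b.  Since g a = f b, along this
  -- arc the g-orbit of a runs parallel to it: ending at b it joins the two f-orbits, ending
  -- at a it closes up without meeting b.
  Returns : ℕ → Set
  Returns j = iter f (suc j) b ≡ a ⊎ iter f (suc j) b ≡ b

  first-return : ∃ λ J → Returns J × (∀ i → i < J → ¬ Returns i)
  first-return = least-witness (λ j → (iter f (suc j) b ≟ a) ⊎-dec (iter f (suc j) b ≟ b))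
                               {proj₁ (F.period b)} (inj₂ (proj₂ (proj₂ (F.period b))))

  J : ℕ
  J = proj₁ first-return

  J-returns : Returns J
  J-returns = proj₁ (proj₂ first-return)

  no-return-before-J : ∀ i → i < J → ¬ Returns i
  no-return-before-J = proj₂ (proj₂ first-return)

  g-follows-f : ∀ i → i ≤ J → iter g (suc i) a ≡ iter f (suc i) b
  g-follows-f zero    _   = trans (g≗f∘τ a) (cong f (transpose-matchˡ a b))
  g-follows-f (suc i) i<J = trans (cong g (g-follows-f i (<⇒≤ i<J))) (trans (g≗f∘τ _) (cong f
    (transpose-mismatch (no-return-before-J i i<J ∘ inj₁) (no-return-before-J i i<J ∘ inj₂))))

  merges : ¬ Reach f a b → Reach g a b
  merges ¬a↝b with J-returns
  ... | inj₁ f¹⁺ᴶb≡a = ⊥-elim (¬a↝b (F.reach-sym (suc J , f¹⁺ᴶb≡a)))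
  ... | inj₂ f¹⁺ᴶb≡b = suc J , trans (g-follows-f J ≤-refl) f¹⁺ᴶb≡b

  splits : Reach f a b → ¬ Reach g a b
  splits a↝b with J-returns
  ... | inj₂ f¹⁺ᴶb≡b with F.reach-sym a↝b
  ...   | k , fᵏb≡a with iter-within-period f f¹⁺ᴶb≡b k fᵏb≡a
  ...     | zero  , _   , b≡a   = ⊥-elim (a≢b (sym b≡a))
  ...     | suc i , i<J , fⁱb≡a = ⊥-elim (no-return-before-J i i<J (inj₁ fⁱb≡a))
  splits a↝b | inj₁ f¹⁺ᴶb≡a = λ (k , gᵏa≡b) →
    b∉g-orbit (iter-within-period g (trans (g-follows-f J ≤-refl) f¹⁺ᴶb≡a) k gᵏa≡b)
    where
    b∉g-orbit : (∃ λ i → i ≤ J × iter g i a ≡ b) → ⊥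
    b∉g-orbit (zero  , _   , a≡b)   = a≢b a≡b
    b∉g-orbit (suc i , i<J , gⁱa≡b) =
      no-return-before-J i i<J (inj₂ (trans (sym (g-follows-f i (<⇒≤ i<J))) gⁱa≡b))

  orbitCount-transpose : orbitCount g ≡ suc (orbitCount f) ⊎ orbitCount f ≡ suc (orbitCount g)
  orbitCount-transpose with F.reach? a b
  ... | yes a↝b = inj₁ (begin
        orbitCount g                               ≡⟨ G.orbitCount-split a b ⟩
        G.touchingMins a b + G.otherMins a b       ≡⟨ cong₂ _+_ (G.touchingMins-unlinked (splits a↝b))
                                                                (sym otherMins-agree) ⟩
        suc (1 + F.otherMins a b)                  ≡⟨ cong (λ c → suc (c + F.otherMins a b))
                                                           (sym (F.touchingMins-linked a↝b)) ⟩
        suc (F.touchingMins a b + F.otherMins a b) ≡⟨ cong suc (sym (F.orbitCount-split a b)) ⟩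
        suc (orbitCount f)                         ∎)
    where open ≡-Reasoning
  ... | no ¬a↝b = inj₂ (begin
        orbitCount f                               ≡⟨ F.orbitCount-split a b ⟩
        F.touchingMins a b + F.otherMins a b       ≡⟨ cong₂ _+_ (F.touchingMins-unlinked ¬a↝b) otherMins-agree ⟩
        suc (1 + G.otherMins a b)                  ≡⟨ cong (λ c → suc (c + G.otherMins a b))
                                                           (sym (G.touchingMins-linked (merges ¬a↝b))) ⟩
        suc (G.touchingMins a b + G.otherMins a b) ≡⟨ cong suc (sym (G.orbitCount-split a b)) ⟩
        suc (orbitCount g)                         ∎)
    where open ≡-Reasoning

SameOrTwoApart : ℕ → ℕ → Set
SameOrTwoApart m n = n ≡ m ⊎ n ≡ 2 + m ⊎ m ≡ 2 + n

orbitCount-transpose₂ : {N : ℕ} {f h : Fin N → Fin N} {a b c e : Fin N} → a ≢ b → c ≢ e →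
  Injective _≡_ _≡_ f → (∀ d → h d ≡ f (transpose a b (transpose c e d))) →
  SameOrTwoApart (orbitCount f) (orbitCount h)
orbitCount-transpose₂ {f = f} {h} {a} {b} {c} {e} a≢b c≢e f-injective h≗f∘τ∘τ =
  compose (Transposition.orbitCount-transpose f g a b a≢b f-injective g-injective (λ _ → refl))
          (Transposition.orbitCount-transpose g h c e c≢e g-injective h-injective h≗f∘τ∘τ)
  where
  g : Fin _ → Fin _
  g d = f (transpose a b d)
  g-injective : Injective _≡_ _≡_ g
  g-injective = transpose-injective a b ∘ f-injective
  h-injective : Injective _≡_ _≡_ h
  h-injective {x} {y} eq =
    transpose-injective c e (g-injective (trans (sym (h≗f∘τ∘τ x)) (trans eq (h≗f∘τ∘τ y))))
  compose : ∀ {l m n} → m ≡ suc l ⊎ l ≡ suc m → n ≡ suc m ⊎ m ≡ suc n → SameOrTwoApart l n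
  compose (inj₁ m≡1+l) (inj₁ n≡1+m) = inj₂ (inj₁ (trans n≡1+m (cong suc m≡1+l)))
  compose (inj₁ m≡1+l) (inj₂ m≡1+n) = inj₁ (suc-injective (trans (sym m≡1+n) m≡1+l))
  compose (inj₂ l≡1+m) (inj₁ n≡1+m) = inj₁ (trans n≡1+m (sym l≡1+m))
  compose (inj₂ l≡1+m) (inj₂ m≡1+n) = inj₂ (inj₂ (trans l≡1+m (cong suc m≡1+n)))

-- Rotation systems and cubic vertices

Cycle3 : {A : Set} → (A → A) → A → A → A → Set
Cycle3 ρ x y z = ρ x ≡ y × ρ y ≡ z × ρ z ≡ x

module _ (G : Graph) where
  open Graph G

  θ-involutive : ∀ d → θ (θ d) ≡ d
  θ-involutive d with remQuot {nE} 2 d in eq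
  ... | e , Fin.zero rewrite remQuot-combine {nE} {2} e (Fin.suc Fin.zero) =
    trans (cong (uncurry combine) (sym eq)) (combine-remQuot {nE} 2 d)
  ... | e , Fin.suc Fin.zero rewrite remQuot-combine {nE} {2} e Fin.zero =
    trans (cong (uncurry combine) (sym eq)) (combine-remQuot {nE} 2 d)

  θ-injective : Injective _≡_ _≡_ θ
  θ-injective {d} {e} θd≡θe = trans (sym (θ-involutive d)) (trans (cong θ θd≡θe) (θ-involutive e))

  record IsRotation (ρ : Dart → Dart) : Set where
    field
      tail-preserving : ∀ d → tail (ρ d) ≡ tail d
      injective       : Injective _≡_ _≡_ ρ
      transitive      : ∀ d d' → tail d ≡ tail d' → ∃ λ k → k < nD × iter ρ k d ≡ d'

  private
    module Conditions (ρ : Dart → Dart) where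
      preservesᵇ : Dart → Bool
      preservesᵇ d = tail (ρ d) ≡ᵇ tail d
      injectiveᵇ transitiveᵇ : Dart → Dart → Bool
      injectiveᵇ  d d' = not (ρ d == ρ d') ∨ (d == d')
      transitiveᵇ d d' = not (tail d ≡ᵇ tail d') ∨ any (λ k → iter ρ k d == d') (upTo nD)

  isRotation⇒IsRotation : ∀ {t} → T (isRotation G t) → IsRotation (rot G t)
  isRotation⇒IsRotation {t} h = record
    { tail-preserving = λ d → ≡ᵇ⇒≡ _ _ (all-allFin⁻ preservesᵇ preserving d)
    ; injective       = λ {d} {d'} ρd≡ρd' → toWitness {a? = d ≟ d'}
        (T-implies⁻ (all-allFin⁻ (injectiveᵇ d) (all-allFin⁻ _ injective d) d') (fromWitness {a? = ρ d ≟ ρ d'} ρd≡ρd'))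
    ; transitive      = λ d d' td≡td' →
        let k , k∈ , hit = find (any⁻ _ _ (T-implies⁻ (all-allFin⁻ (transitiveᵇ d) (all-allFin⁻ _ transitive d) d')
                                                      (≡⇒≡ᵇ _ _ td≡td')))
        in k , ∈-upTo⁻ k∈ , toWitness {a? = iter ρ k d ≟ d'} hit
    }
    where
    ρ = rot G t
    open Conditions ρ
    preserving : T (all preservesᵇ (allFin nD))
    preserving = proj₁ (to T-∧ h)
    injective : T (all (λ d → all (injectiveᵇ d) (allFin nD)) (allFin nD))
    injective = proj₁ (to T-∧ (proj₂ (to (T-∧ {all preservesᵇ (allFin nD)}) h)))
    transitive : T (all (λ d → all (transitiveᵇ d) (allFin nD)) (allFin nD))
    transitive = proj₂ (to T-∧ (proj₂ (to (T-∧ {all preservesᵇ (allFin nD)}) h)))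

  IsRotation⇒isRotation : ∀ {t} → IsRotation (rot G t) → T (isRotation G t)
  IsRotation⇒isRotation {t} R = from T-∧ (preserving , from T-∧ (injective , transitive))
    where
    ρ = rot G t
    open Conditions ρ
    open IsRotation R renaming (injective to ρ-injective; transitive to ρ-transitive)
    preserving : T (all preservesᵇ (allFin nD))
    preserving = all-allFin⁺ preservesᵇ (λ d → ≡⇒≡ᵇ _ _ (tail-preserving d))
    injective : T (all (λ d → all (injectiveᵇ d) (allFin nD)) (allFin nD))
    injective = all-allFin⁺ _ (λ d → all-allFin⁺ (injectiveᵇ d) (λ d' →
      T-implies⁺ (fromWitness {a? = d ≟ d'} ∘ ρ-injective ∘ toWitness {a? = ρ d ≟ ρ d'})))
    transitive : T (all (λ d → all (transitiveᵇ d) (allFin nD)) (allFin nD))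
    transitive = all-allFin⁺ _ (λ d → all-allFin⁺ (transitiveᵇ d) (λ d' → T-implies⁺ (λ td≡td' →
      let k , k<nD , hit = ρ-transitive d d' (≡ᵇ⇒≡ _ _ td≡td')
      in any⁺ _ (lose (∈-upTo⁺ k<nD) (fromWitness {a? = iter ρ k d ≟ d'} hit)))))

  IsRotation-cong : ∀ {ρ σ} → (∀ d → ρ d ≡ σ d) → IsRotation ρ → IsRotation σ
  IsRotation-cong {ρ} {σ} ρ≗σ R = record
    { tail-preserving = λ d → trans (cong tail (sym (ρ≗σ d))) (tail-preserving d)
    ; injective       = λ {d} {d'} σd≡σd' → injective (trans (ρ≗σ d) (trans σd≡σd' (sym (ρ≗σ d'))))
    ; transitive      = λ d d' td≡td' → let k , k<nD , hit = transitive d d' td≡td'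
                                        in k , k<nD , trans (sym (iter-cong ρ≗σ k d)) hit
    }
    where open IsRotation R

  -- faceCount G (rot G t) unfolds to numFaces G t.
  faceCount : (Dart → Dart) → ℕ
  faceCount ρ = orbitCount (λ d → ρ (θ d))

  degree : ℕ → ℕ
  degree v = count (λ d → tail d ≡ᵇ v) (allFin nD)

  Cubic : Set
  Cubic = ∀ d → degree (tail d) ≡ 3

  record ThreeDartsAt (x : Dart) : Set where
    field
      y z        : Dart
      x≢y        : x ≢ y
      y≢z        : y ≢ z
      x≢z        : x ≢ z
      tail-y     : tail y ≡ tail x
      tail-z     : tail z ≡ tail x
      exhaustive : ∀ d → tail d ≡ tail x → d ≡ x ⊎ d ≡ y ⊎ d ≡ z

  threeDartsAt : Cubic → ∀ x → ThreeDartsAt x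
  threeDartsAt cubic x with count-allFin-≡3 (≡⇒≡ᵇ (tail x) (tail x) refl) (cubic x)
  ... | y , z , x≢y , y≢z , x≢z , qy , qz , only = record
    { y = y ; z = z ; x≢y = x≢y ; y≢z = y≢z ; x≢z = x≢z
    ; tail-y = ≡ᵇ⇒≡ _ _ qy ; tail-z = ≡ᵇ⇒≡ _ _ qz
    ; exhaustive = λ d td≡tx → only d (≡⇒≡ᵇ _ _ td≡tx) }

  module _ {ρ : Dart → Dart} (R : IsRotation ρ) where
    open IsRotation R

    tail-iter : ∀ k d → tail (iter ρ k d) ≡ tail d
    tail-iter zero    d = refl
    tail-iter (suc k) d = trans (tail-preserving _) (tail-iter k d)

    fixed-point⇒only-dart : ∀ {w w'} → ρ w ≡ w → tail w' ≡ tail w → w' ≡ w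
    fixed-point⇒only-dart {w} {w'} ρw≡w tw'≡tw with transitive w w' (sym tw'≡tw)
    ... | k , _ , ρᵏw≡w' = trans (sym ρᵏw≡w') (stays k)
      where
      stays : ∀ k → iter ρ k w ≡ w
      stays zero    = refl
      stays (suc k) = trans (cong ρ (stays k)) ρw≡w

    three-cycle : ∀ {x y z} → x ≢ y → y ≢ z → x ≢ z → tail y ≡ tail x → tail z ≡ tail x →
      (∀ d → tail d ≡ tail x → d ≡ x ⊎ d ≡ y ⊎ d ≡ z) → ρ x ≡ y → Cycle3 ρ x y z
    three-cycle {x} {y} {z} x≢y y≢z x≢z ty tz exhaustive ρx≡y = ρx≡y , ρy≡z , ρz≡x
      where
      ρz≡x : ρ z ≡ x
      ρz≡x with exhaustive (ρ z) (trans (tail-preserving z) tz)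
      ... | inj₁ ρz≡x        = ρz≡x
      ... | inj₂ (inj₁ ρz≡y) = ⊥-elim (x≢z (sym (injective (trans ρz≡y (sym ρx≡y)))))
      ... | inj₂ (inj₂ ρz≡z) = ⊥-elim (y≢z (fixed-point⇒only-dart ρz≡z (trans ty (sym tz))))
      ρy≡z : ρ y ≡ z
      ρy≡z with exhaustive (ρ y) (trans (tail-preserving y) ty)
      ... | inj₁ ρy≡x        = ⊥-elim (y≢z (injective (trans ρy≡x (sym ρz≡x))))
      ... | inj₂ (inj₁ ρy≡y) = ⊥-elim (x≢y (fixed-point⇒only-dart ρy≡y (sym ty)))
      ... | inj₂ (inj₂ ρy≡z) = ρy≡z

    rotation-at-cubic-vertex : ∀ {x} (D : ThreeDartsAt x) →
      Cycle3 ρ x (ThreeDartsAt.y D) (ThreeDartsAt.z D) ⊎ Cycle3 ρ x (ThreeDartsAt.z D) (ThreeDartsAt.y D)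
    rotation-at-cubic-vertex {x} D = classify (exhaustive (ρ x) (tail-preserving x))
      where
      open ThreeDartsAt D
      classify : ρ x ≡ x ⊎ ρ x ≡ y ⊎ ρ x ≡ z → Cycle3 ρ x y z ⊎ Cycle3 ρ x z y
      classify (inj₁ ρx≡x)        = ⊥-elim (x≢y (sym (fixed-point⇒only-dart ρx≡x tail-y)))
      classify (inj₂ (inj₁ ρx≡y)) = inj₁ (three-cycle x≢y y≢z x≢z tail-y tail-z exhaustive ρx≡y)
      classify (inj₂ (inj₂ ρx≡z)) = inj₂ (three-cycle x≢z (y≢z ∘ sym) x≢y tail-z tail-y
                                      (λ d td≡tx → Sum.map₂ Sum.swap (exhaustive d td≡tx)) ρx≡z)

  reversing-three-cycle : ∀ {ρ ρ' x y z} → IsRotation ρ → x ≢ y → y ≢ z → x ≢ z →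
    Cycle3 ρ x y z → Cycle3 ρ' x z y → (∀ w → w ≢ x → w ≢ y → w ≢ z → ρ' w ≡ ρ w) →
    SameOrTwoApart (faceCount ρ) (faceCount ρ')
  reversing-three-cycle {ρ} {ρ'} {x} {y} {z} R x≢y y≢z x≢z (ρx≡y , ρy≡z , ρz≡x) (ρ'x≡z , ρ'z≡y , ρ'y≡x) outside =
    orbitCount-transpose₂ (x≢y ∘ θ-injective) (y≢z ∘ θ-injective) (θ-injective ∘ IsRotation.injective R) faces
    where
    open ≡-Reasoning
    -- (x z y) = (x y z) ∘ (x y) ∘ (y z)
    ρ'-as-product : ∀ w → ρ' w ≡ ρ (transpose x y (transpose y z w))
    ρ'-as-product w with locate3 x y z w
    ... | inj₁ refl = sym (begin
      ρ (transpose x y (transpose y z x)) ≡⟨ cong (ρ ∘ transpose x y) (transpose-mismatch x≢y x≢z) ⟩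
      ρ (transpose x y x)                 ≡⟨ cong ρ (transpose-matchˡ x y) ⟩
      ρ y                                 ≡⟨ trans ρy≡z (sym ρ'x≡z) ⟩
      ρ' x                                ∎)
    ... | inj₂ (inj₁ refl) = sym (begin
      ρ (transpose x y (transpose y z y)) ≡⟨ cong (ρ ∘ transpose x y) (transpose-matchˡ y z) ⟩
      ρ (transpose x y z)                 ≡⟨ cong ρ (transpose-mismatch (x≢z ∘ sym) (y≢z ∘ sym)) ⟩
      ρ z                                 ≡⟨ trans ρz≡x (sym ρ'y≡x) ⟩
      ρ' y                                ∎)
    ... | inj₂ (inj₂ (inj₁ refl)) = sym (begin
      ρ (transpose x y (transpose y z z)) ≡⟨ cong (ρ ∘ transpose x y) (transpose-matchʳ y z) ⟩
      ρ (transpose x y y)                 ≡⟨ cong ρ (transpose-matchʳ x y) ⟩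
      ρ x                                 ≡⟨ trans ρx≡y (sym ρ'z≡y) ⟩
      ρ' z                                ∎)
    ... | inj₂ (inj₂ (inj₂ (w≢x , w≢y , w≢z))) = trans (outside w w≢x w≢y w≢z)
      (sym (cong ρ (trans (cong (transpose x y) (transpose-mismatch w≢y w≢z)) (transpose-mismatch w≢x w≢y))))
    faces : ∀ d → ρ' (θ d) ≡ ρ (θ (transpose (θ x) (θ y) (transpose (θ y) (θ z) d)))
    faces d = begin
      ρ' (θ d)                                                ≡⟨ ρ'-as-product (θ d) ⟩
      ρ (transpose x y (transpose y z (θ d)))                 ≡⟨ cong (ρ ∘ transpose x y) (sym (conjugate y z d)) ⟩
      ρ (transpose x y (θ (transpose (θ y) (θ z) d)))         ≡⟨ cong ρ (sym (conjugate x y _)) ⟩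
      ρ (θ (transpose (θ x) (θ y) (transpose (θ y) (θ z) d))) ∎
      where
      conjugate : ∀ i j d → θ (transpose (θ i) (θ j) d) ≡ transpose i j (θ d)
      conjugate = transpose-conjugate {θ = θ} θ-involutive

  faceCount-local-change : Cubic → ∀ {ρ ρ' v} → IsRotation ρ → IsRotation ρ' →
    (∀ d → tail d ≢ v → ρ d ≡ ρ' d) → SameOrTwoApart (faceCount ρ) (faceCount ρ')
  faceCount-local-change cubic {ρ} {ρ'} {v} R R' agree with any? (λ d → tail d ℕ.≟ v)
  ... | no no-dart-at-v = inj₁ (orbitCount-cong (λ d → sym (agree (θ d) (λ t → no-dart-at-v (θ d , t)))))
  ... | yes (x , tx≡v) = compare (rotation-at-cubic-vertex R D) (rotation-at-cubic-vertex R' D)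
    where
    D = threeDartsAt cubic x
    open ThreeDartsAt D
    at-v : ∀ {w} → tail w ≡ v → w ≡ x ⊎ w ≡ y ⊎ w ≡ z
    at-v tw≡v = exhaustive _ (trans tw≡v (sym tx≡v))
    outside : ∀ w → w ≢ x → w ≢ y → w ≢ z → ρ' w ≡ ρ w
    outside w w≢x w≢y w≢z = sym (agree w (Sum.[ w≢x , Sum.[ w≢y , w≢z ] ] ∘ at-v))
    same : (∀ {w} → w ≡ x ⊎ w ≡ y ⊎ w ≡ z → ρ' w ≡ ρ w) → SameOrTwoApart (faceCount ρ) (faceCount ρ')
    same agree-at-v = inj₁ (orbitCount-cong (λ d → ρ'≗ρ (θ d)))
      where
      ρ'≗ρ : ∀ w → ρ' w ≡ ρ w
      ρ'≗ρ w with tail w ℕ.≟ v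
      ... | yes tw≡v = agree-at-v (at-v tw≡v)
      ... | no  tw≢v = sym (agree w tw≢v)
    compare : Cycle3 ρ x y z ⊎ Cycle3 ρ x z y → Cycle3 ρ' x y z ⊎ Cycle3 ρ' x z y →
              SameOrTwoApart (faceCount ρ) (faceCount ρ')
    compare (inj₁ (ρx , ρy , ρz)) (inj₁ (ρ'x , ρ'y , ρ'z)) = same λ
      { (inj₁ refl)        → trans ρ'x (sym ρx)
      ; (inj₂ (inj₁ refl)) → trans ρ'y (sym ρy)
      ; (inj₂ (inj₂ refl)) → trans ρ'z (sym ρz) }
    compare (inj₂ (ρx , ρz , ρy)) (inj₂ (ρ'x , ρ'z , ρ'y)) = same λ
      { (inj₁ refl)        → trans ρ'x (sym ρx)
      ; (inj₂ (inj₁ refl)) → trans ρ'y (sym ρy)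
      ; (inj₂ (inj₂ refl)) → trans ρ'z (sym ρz) }
    compare (inj₁ c) (inj₂ c') = reversing-three-cycle R x≢y y≢z x≢z c c' outside
    compare (inj₂ c) (inj₁ c') =
      reversing-three-cycle R x≢z (y≢z ∘ sym) x≢y c c' (λ w w≢x w≢z w≢y → outside w w≢x w≢y w≢z)

-- Interpolating between two embeddings of a cubic graph

intermediate-value : (s : ℕ → ℕ) (M : ℕ) {t a : ℕ} → (∀ m → m < M → SameOrTwoApart (s m) (s (suc m))) →
  s 0 ≡ t + 2 * a → s M ≤ t → ∃ λ m → s m ≡ t
intermediate-value s zero {t} {zero} _ s₀≡t+0 _ = 0 , trans s₀≡t+0 (+-identityʳ t)
intermediate-value s zero {t} {suc a} _ s₀≡ s₀≤t
  with +-cancelˡ-≤ t _ 0 (subst (_≤ t + 0) s₀≡ (subst (s 0 ≤_) (sym (+-identityʳ t)) s₀≤t))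
... | ()
intermediate-value s (suc M) {t} {a} steps s₀≡ s₁₊ₘ≤t = first-step (steps 0 z<s)
  where
  two-more : ∀ t a → t + 2 * suc a ≡ 2 + (t + 2 * a)
  two-more = solve-∀
  from-one : ∀ {b} → s 1 ≡ t + 2 * b → ∃ λ m → s m ≡ t
  from-one {b} s₁≡ with intermediate-value (s ∘ suc) M {t} {b} (λ m m<M → steps (suc m) (s<s m<M)) s₁≡ s₁₊ₘ≤t
  ... | m , s₁₊ₘ≡t = suc m , s₁₊ₘ≡t
  descend : ∀ {b} → s 0 ≡ t + 2 * b → s 0 ≡ 2 + s 1 → ∃ λ m → s m ≡ t
  descend {zero}  s₀≡t+0 _     = 0 , trans s₀≡t+0 (+-identityʳ t)
  descend {suc b} s₀≡ s₀≡2+s₁ =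
    from-one {b} (suc-injective (suc-injective (trans (sym s₀≡2+s₁) (trans s₀≡ (two-more t b)))))
  first-step : SameOrTwoApart (s 0) (s 1) → ∃ λ m → s m ≡ t
  first-step (inj₁ s₁≡s₀)          = from-one {a} (trans s₁≡s₀ s₀≡)
  first-step (inj₂ (inj₁ s₁≡2+s₀)) = from-one {suc a} (trans s₁≡2+s₀ (trans (cong (2 +_) s₀≡) (sym (two-more t a))))
  first-step (inj₂ (inj₂ s₀≡2+s₁)) = descend {a} s₀≡ s₀≡2+s₁

<ᵇ-suc : ∀ {v m} → v ≢ m → (v <ᵇ m) ≡ (v <ᵇ suc m)
<ᵇ-suc {zero}  {zero}  0≢0 = ⊥-elim (0≢0 refl)
<ᵇ-suc {zero}  {suc m} _   = refl
<ᵇ-suc {suc v} {zero}  _   = refl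
<ᵇ-suc {suc v} {suc m} v≢m = <ᵇ-suc (v≢m ∘ cong suc)

module _ (G : Graph) where
  open Graph G

  genusCoeff≢0⇒embedding : ∀ {i} → genusCoeff G i ≢ 0 → ∃ λ t → T (isRotation G t) × T (hasGenus G i t)
  genusCoeff≢0⇒embedding {i} gᵢ≢0 with count≢0⇒∃ {p = hasGenus G i} (allRotationSystems G) gᵢ≢0
  ... | t , t∈ , genus-i =
    t , from T-≡ (proj₂ (∈-filter⁻ (λ t → isRotation G t Bool.≟ true) {xs = allVecs (allFin nD) nD} t∈)) , genus-i

  embedding⇒genusCoeff≢0 : ∀ {i t} → T (isRotation G t) → T (hasGenus G i t) → genusCoeff G i ≢ 0
  embedding⇒genusCoeff≢0 {i} {t} rotation = ∈⇒count≢0 {p = hasGenus G i}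
    (∈-filter⁺ (λ t → isRotation G t Bool.≟ true) (∈-allVecs (allFin nD) nD t (λ _ → ∈-allFin _)) (to T-≡ rotation))

  select : (ℕ → Bool) → (Dart → Dart) → (Dart → Dart) → Dart → Dart
  select c ρ₀ ρ₁ d = (if c (tail d) then ρ₁ else ρ₀) d

  IsRotation-select : ∀ {ρ₀ ρ₁} → IsRotation G ρ₀ → IsRotation G ρ₁ → ∀ c → IsRotation G (select c ρ₀ ρ₁)
  IsRotation-select {ρ₀} {ρ₁} R₀ R₁ c = record
    { tail-preserving = λ d → tail-preserving (R (c (tail d))) d
    ; injective       = λ {d} {d'} eq → injective (R (c (tail d)))
        (trans eq (cong (λ b → (if b then ρ₁ else ρ₀) d') (cong c (sym (same-tail eq)))))
    ; transitive      = λ d d' td≡td' → let k , k<nD , hit = transitive (R (c (tail d))) d d' td≡td'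
                                        in k , k<nD , trans (iter-select d k) hit
    }
    where
    open IsRotation
    R : ∀ b → IsRotation G (if b then ρ₁ else ρ₀)
    R true  = R₁
    R false = R₀
    same-tail : ∀ {d d'} → select c ρ₀ ρ₁ d ≡ select c ρ₀ ρ₁ d' → tail d ≡ tail d'
    same-tail {d} {d'} eq =
      trans (sym (tail-preserving (R (c (tail d))) d)) (trans (cong tail eq) (tail-preserving (R (c (tail d'))) d'))
    iter-select : ∀ d k → iter (select c ρ₀ ρ₁) k d ≡ iter (if c (tail d) then ρ₁ else ρ₀) k d
    iter-select d zero    = refl
    iter-select d (suc k) rewrite iter-select d k =
      cong (λ b → (if b then ρ₁ else ρ₀) (iter (if c (tail d) then ρ₁ else ρ₀) k d))
           (cong c (tail-iter G (R (c (tail d))) k d))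

  vertexBound : ℕ
  vertexBound = suc (max 0 (map tail (allFin nD)))

  tail<vertexBound : ∀ d → tail d < vertexBound
  tail<vertexBound d = s≤s (All.lookup (xs≤max 0 (map tail (allFin nD))) (∈-map⁺ tail (∈-allFin d)))

  module _ {ρ₀ ρ₁ : Dart → Dart} (R₀ : IsRotation G ρ₀) (R₁ : IsRotation G ρ₁) where

    mix : ℕ → Dart → Dart
    mix m = select (_<ᵇ m) ρ₀ ρ₁

    IsRotation-mix : ∀ m → IsRotation G (mix m)
    IsRotation-mix m = IsRotation-select R₀ R₁ (_<ᵇ m)

    mix-suc : ∀ m d → tail d ≢ m → mix m d ≡ mix (suc m) d
    mix-suc m d td≢m = cong (λ b → (if b then ρ₁ else ρ₀) d) (<ᵇ-suc td≢m)

    mix-vertexBound : ∀ d → mix vertexBound d ≡ ρ₁ d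
    mix-vertexBound d = cong (λ b → (if b then ρ₁ else ρ₀) d) (to T-≡ (<⇒<ᵇ (tail<vertexBound d)))

    faces-interpolate : Cubic G → ∀ {t a} → faceCount G ρ₀ ≡ t + 2 * a → faceCount G ρ₁ ≤ t →
      ∃ λ ρ → IsRotation G ρ × faceCount G ρ ≡ t
    faces-interpolate cubic {t} {a} F₀≡ F₁≤t = realise (intermediate-value (faceCount G ∘ mix) vertexBound {t} {a}
      (λ m _ → faceCount-local-change G cubic (IsRotation-mix m) (IsRotation-mix (suc m)) (mix-suc m))
      F₀≡
      (subst (_≤ t) (orbitCount-cong (λ d → sym (mix-vertexBound (θ d)))) F₁≤t))
      where
      realise : (∃ λ m → faceCount G (mix m) ≡ t) → ∃ λ ρ → IsRotation G ρ × faceCount G ρ ≡ t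
      realise (m , Fₘ≡t) = mix m , IsRotation-mix m , Fₘ≡t

  -- By Euler's formula F = 2 + E - V - 2g, genera i ≤ k ≤ j correspond to face counts
  -- F₀ ≥ F ≥ F₁ of the same parity.
  genus-interpolation : Cubic G → ∀ {i k j t₀ t₁} →
    T (isRotation G t₀) → T (hasGenus G i t₀) → T (isRotation G t₁) → T (hasGenus G j t₁) →
    i ≤ k → k ≤ j → ∃ λ t → T (isRotation G t) × T (hasGenus G k t)
  genus-interpolation cubic {i} {t₀ = t₀} {t₁} rotation₀ genus₀ rotation₁ genus₁ i≤k k≤j
    with m≤n⇒∃[o]m+o≡n i≤k | m≤n⇒∃[o]m+o≡n k≤j
  ... | e , refl | c , refl = realise (faces-interpolate R₀ R₁ cubic {a = e} F₀≡ (m≤m+n F₁ (2 * c)))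
    where
    R₀ = isRotation⇒IsRotation G {t₀} rotation₀
    R₁ = isRotation⇒IsRotation G {t₁} rotation₁
    F₀ = numFaces G t₀
    F₁ = numFaces G t₁
    euler₀ : nV + F₀ + 2 * i ≡ 2 + nE
    euler₀ = ≡ᵇ⇒≡ _ _ genus₀
    euler₁ : nV + F₁ + 2 * (i + e + c) ≡ 2 + nE
    euler₁ = ≡ᵇ⇒≡ _ _ genus₁
    F₀≡ : F₀ ≡ (F₁ + 2 * c) + 2 * e
    F₀≡ = +-cancelˡ-≡ (nV + 2 * i) _ _ (begin
      nV + 2 * i + F₀                   ≡⟨ regroup₀ nV F₀ i ⟩
      nV + F₀ + 2 * i                   ≡⟨ trans euler₀ (sym euler₁) ⟩
      nV + F₁ + 2 * (i + e + c)         ≡⟨ regroup₁ nV F₁ i e c ⟩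
      nV + 2 * i + (F₁ + 2 * c + 2 * e) ∎)
      where
      open ≡-Reasoning
      regroup₀ : ∀ v f i → v + 2 * i + f ≡ v + f + 2 * i
      regroup₀ = solve-∀
      regroup₁ : ∀ v f i e c → v + f + 2 * (i + e + c) ≡ v + 2 * i + (f + 2 * c + 2 * e)
      regroup₁ = solve-∀
    realise : (∃ λ ρ → IsRotation G ρ × faceCount G ρ ≡ F₁ + 2 * c) →
              ∃ λ t → T (isRotation G t) × T (hasGenus G (i + e) t)
    realise (ρ , R , Fρ≡) = Vec.tabulate ρ , rotation , ≡⇒≡ᵇ _ _ (begin
      nV + numFaces G (Vec.tabulate ρ) + 2 * (i + e) ≡⟨ cong (λ f → nV + f + 2 * (i + e)) faces ⟩
      nV + (F₁ + 2 * c) + 2 * (i + e)               ≡⟨ regroup nV F₁ i e c ⟩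
      nV + F₁ + 2 * (i + e + c)                     ≡⟨ euler₁ ⟩
      2 + nE                                        ∎)
      where
      open ≡-Reasoning
      rotation : T (isRotation G (Vec.tabulate ρ))
      rotation = IsRotation⇒isRotation G {Vec.tabulate ρ} (IsRotation-cong G (λ d → sym (lookup∘tabulate ρ d)) R)
      faces : numFaces G (Vec.tabulate ρ) ≡ F₁ + 2 * c
      faces = trans (orbitCount-cong (λ d → lookup∘tabulate ρ (θ d))) Fρ≡
      regroup : ∀ v f i e c → v + (f + 2 * c) + 2 * (i + e) ≡ v + f + 2 * (i + e + c)
      regroup = solve-∀

  cubic-no-internal-zero : Cubic G → ¬ HasInternalZero (genusCoeff G)
  cubic-no-internal-zero cubic (i , k , j , i<k , k<j , gᵢ≢0 , gⱼ≢0 , gₖ≡0)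
    with genusCoeff≢0⇒embedding {i} gᵢ≢0 | genusCoeff≢0⇒embedding {j} gⱼ≢0
  ... | t₀ , rotation₀ , genus₀ | t₁ , rotation₁ , genus₁
    with genus-interpolation cubic {i} {k} {j} {t₀} {t₁} rotation₀ genus₀ rotation₁ genus₁ (<⇒≤ i<k) (<⇒≤ k<j)
  ...   | t , rotation , genus-k = embedding⇒genusCoeff≢0 {k} {t} rotation genus-k gₖ≡0

-- The iterated claws are cubic

indicator : Bool → ℕ
indicator true  = 1
indicator false = 0

if-suc≡indicator+ : ∀ b n → (if b then suc n else n) ≡ indicator b + n
if-suc≡indicator+ true  n = refl
if-suc≡indicator+ false n = refl

endpointCount : List (ℕ × ℕ) → ℕ → ℕ
endpointCount []            w = 0
endpointCount ((a , b) ∷ E) w = indicator (a ≡ᵇ w) + (indicator (b ≡ᵇ w) + endpointCount E w)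

tail-∷ : ∀ nV e E d → Graph.tail (mkGraph nV (e ∷ E)) (Fin.suc (Fin.suc d)) ≡ Graph.tail (mkGraph nV E) d
tail-∷ nV e E d with Fin.quotRem {length E} 2 d
... | Fin.zero , _         = refl
... | Fin.suc Fin.zero , _ = refl

degree-mkGraph : ∀ nV E w → degree (mkGraph nV E) w ≡ endpointCount E w
degree-mkGraph nV []            w = refl
degree-mkGraph nV ((a , b) ∷ E) w =
  trans (if-suc≡indicator+ (a ≡ᵇ w) _) (cong (indicator (a ≡ᵇ w) +_)
    (trans (if-suc≡indicator+ (b ≡ᵇ w) _) (cong (indicator (b ≡ᵇ w) +_)
      (trans (count-tabulate (length E * 2) (Fin.suc ∘ Fin.suc) (λ d → tail d ≡ᵇ w))
        (trans (count-cong (λ d → cong (_≡ᵇ w) (tail-∷ nV (a , b) E d)) (allFin (length E * 2)))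
               (degree-mkGraph nV E w))))))
  where open Graph (mkGraph nV ((a , b) ∷ E)) using (tail)

inFourFrom : ℕ → ℕ → ℕ
inFourFrom v w = indicator (v ≡ᵇ w) + indicator (v + 1 ≡ᵇ w) + indicator (v + 2 ≡ᵇ w) + indicator (v + 3 ≡ᵇ w)

indicator-<ᵇ-+suc : ∀ w v k → indicator (w <ᵇ v + suc k) ≡ indicator (w <ᵇ v + k) + indicator (v + k ≡ᵇ w)
indicator-<ᵇ-+suc w v k rewrite +-suc v k = below-suc w (v + k)
  where
  below-suc : ∀ w u → indicator (w <ᵇ suc u) ≡ indicator (w <ᵇ u) + indicator (u ≡ᵇ w)
  below-suc zero    zero    = refl
  below-suc zero    (suc u) = refl
  below-suc (suc w) zero    = refl
  below-suc (suc w) (suc u) = below-suc w u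

indicator-<ᵇ-+4 : ∀ w v → indicator (w <ᵇ v + 4) ≡ indicator (w <ᵇ v) + inFourFrom v w
indicator-<ᵇ-+4 w v
  rewrite indicator-<ᵇ-+suc w v 3 | indicator-<ᵇ-+suc w v 2 | indicator-<ᵇ-+suc w v 1 | indicator-<ᵇ-+suc w v 0
        | +-identityʳ v =
  reassociate (indicator (w <ᵇ v)) (indicator (v ≡ᵇ w)) (indicator (v + 1 ≡ᵇ w)) (indicator (v + 2 ≡ᵇ w))
              (indicator (v + 3 ≡ᵇ w))
  where
  reassociate : ∀ a b c d e → a + b + c + d + e ≡ a + (b + c + d + e)
  reassociate = solve-∀

rootEdges : ℕ → ℕ → ℕ → ℕ → List (ℕ × ℕ) → List (ℕ × ℕ)
rootEdges r x₁ x₂ x₃ rest = (r , x₁) ∷ (r , x₂) ∷ (r , x₃) ∷ rest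

subdividedEdges : ℕ → ℕ → ℕ → ℕ → ℕ → List (ℕ × ℕ) → List (ℕ × ℕ)
subdividedEdges v r x₁ x₂ x₃ rest =
  (r , v) ∷ (v , x₁) ∷ (r , v + 1) ∷ (v + 1 , x₂) ∷ (r , v + 2) ∷ (v + 2 , x₃) ∷ rest

record ClawShape (n : ℕ) : Set where
  field
    v r x₁ x₂ x₃ : ℕ
    rest         : List (ℕ × ℕ)
    shape        : YData n ≡ (v , r , rootEdges r x₁ x₂ x₃ rest)
    endpoints    : ∀ w → endpointCount (rootEdges r x₁ x₂ x₃ rest) w ≡ 3 * indicator (w <ᵇ v)

YData-suc : ∀ {n v r x₁ x₂ x₃ rest} → YData n ≡ (v , r , rootEdges r x₁ x₂ x₃ rest) →
  YData (suc n) ≡ (v + 4 , v + 3 , rootEdges (v + 3) v (v + 1) (v + 2) (subdividedEdges v r x₁ x₂ x₃ rest))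
YData-suc shape rewrite shape = refl

claw-shape : ∀ n → ClawShape n
claw-shape zero = record
  { v = 2 ; r = 0 ; x₁ = 1 ; x₂ = 1 ; x₃ = 1 ; rest = [] ; shape = refl
  ; endpoints = λ { zero → refl ; (suc zero) → refl ; (suc (suc w)) → refl } }
claw-shape (suc n) with claw-shape n
... | record { v = v ; r = r ; x₁ = x₁ ; x₂ = x₂ ; x₃ = x₃ ; rest = rest ; shape = shape ; endpoints = endpoints } =
  record
  { v = v + 4 ; r = v + 3 ; x₁ = v ; x₂ = v + 1 ; x₃ = v + 2
  ; rest = subdividedEdges v r x₁ x₂ x₃ rest
  ; shape = YData-suc {n} shape
  ; endpoints = λ w → begin
      endpointCount (rootEdges (v + 3) v (v + 1) (v + 2) (subdividedEdges v r x₁ x₂ x₃ rest)) w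
        ≡⟨ regroup (indicator (v + 3 ≡ᵇ w)) (indicator (v ≡ᵇ w)) (indicator (v + 1 ≡ᵇ w)) (indicator (v + 2 ≡ᵇ w))
                   (indicator (r ≡ᵇ w)) (indicator (x₁ ≡ᵇ w)) (indicator (x₂ ≡ᵇ w)) (indicator (x₃ ≡ᵇ w))
                   (endpointCount rest w) ⟩
      3 * inFourFrom v w + endpointCount (rootEdges r x₁ x₂ x₃ rest) w
        ≡⟨ cong (3 * inFourFrom v w +_) (endpoints w) ⟩
      3 * inFourFrom v w + 3 * indicator (w <ᵇ v)
        ≡⟨ sym (trans (cong (3 *_) (indicator-<ᵇ-+4 w v)) (distrib (indicator (w <ᵇ v)) (inFourFrom v w))) ⟩
      3 * indicator (w <ᵇ v + 4) ∎ }
  where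
  open ≡-Reasoning
  regroup : ∀ u s₁ s₂ s₃ r x₁ x₂ x₃ o →
    u + (s₁ + (u + (s₂ + (u + (s₃ + (r + (s₁ + (s₁ + (x₁ + (r + (s₂ + (s₂ + (x₂ + (r + (s₃ + (s₃ + (x₃ + o)))))))))))))))))
    ≡ 3 * (s₁ + s₂ + s₃ + u) + (r + (x₁ + (r + (x₂ + (r + (x₃ + o))))))
  regroup = solve-∀
  distrib : ∀ a b → 3 * (a + b) ≡ 3 * b + 3 * a
  distrib = solve-∀

Y-degree : ∀ n w → degree (Y n) w ≡ 3 * indicator (w <ᵇ proj₁ (YData n))
Y-degree n w with claw-shape n
... | record { v = v ; r = r ; x₁ = x₁ ; x₂ = x₂ ; x₃ = x₃ ; rest = rest ; shape = shape ; endpoints = endpoints }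
  rewrite shape = trans (degree-mkGraph v (rootEdges r x₁ x₂ x₃ rest) w) (endpoints w)

Y-cubic : ∀ n → Cubic (Y n)
Y-cubic n d = occupied {tail d <ᵇ proj₁ (YData n)} (Y-degree n (tail d))
  where
  open Graph (Y n) using (tail)
  occupied : ∀ {b} → degree (Y n) (tail d) ≡ 3 * indicator b → degree (Y n) (tail d) ≡ 3
  occupied {true}  deg≡3 = deg≡3
  occupied {false} deg≡0 =
    ⊥-elim (∈⇒count≢0 {p = λ e → tail e ≡ᵇ tail d} (∈-allFin d) (≡⇒≡ᵇ (tail d) _ refl) deg≡0)

corollary3p4 : (n : ℕ) → ¬ HasInternalZero (genusCoeff (Y n))
corollary3p4 n = cubic-no-internal-zero (Y n) (Y-cubic n)
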